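{- Let $k\ge 2$ and $\delta\ge k$ be integers and let $G$ be a connected graph of order $n\ge 2\delta-k+5$, with $m$ edges and minimum degree $\delta(G)=\delta$. If $$m>\tfrac12 n(n-1)-(\delta-k+3)(n-\delta-2),$$ then $G$ is $k$-connected unless $G$ is a subgraph of $A(n,k,\delta)$.
   Context: All graphs are simple and undirected. A graph is $k$-connected if it has more than $k$ vertices and remains connected whenever fewer than $k$ vertices are deleted. $G\vee H$ denotes the join of $G$ and $H$ (disjoint union plus all edges between them), and $K_r$ is the complete graph on $r$ vertices. $A(n,k,\delta)=K_{k-1}\vee(K_{\delta-k+2}\cup K_{n-\delta-1})$. -}

module Defs where

open import Data.Nat using (ℕ; zero; suc; _+_; _*_; _∸_; _≤_; _<_; _<ᵇ_)
open import Data.Bool using (Bool; true; false; if_then_else_)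
open import Data.Fin using (Fin; toℕ)
open import Data.Fin.Subset using (Subset; _∉_; ∣_∣)
open import Data.List using (List; allFin; map)
open import Data.Nat.ListAction using (sum)
open import Data.Product using (Σ; _×_; ∃)
open import Data.Sum using (_⊎_)
open import Relation.Binary.PropositionalEquality using (_≡_; _≢_)
open import Function.Definitions using (Injective)

record Graph (n : ℕ) : Set where
  field
    adj    : Fin n → Fin n → Bool
    sym    : ∀ u v → adj u v ≡ adj v u
    irrefl : ∀ v → adj v v ≡ false
open Graph public

Adj : ∀ {n} → Graph n → Fin n → Fin n → Set
Adj G u v = adj G u v ≡ true

degree : ∀ {n} → Graph n → Fin n → ℕ
degree {n} G v = sum (map (λ u → if adj G v u then 1 else 0) (allFin n))

edgeCount : ∀ {n} → Graph n → ℕ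
edgeCount {n} G =
  sum (map (λ u → sum (map (λ v → if adj G u v then (if toℕ u <ᵇ toℕ v then 1 else 0) else 0)
                             (allFin n)))
           (allFin n))

MinDegree : ∀ {n} → Graph n → ℕ → Set
MinDegree G d = (∀ v → d ≤ degree G v) × ∃ (λ v → degree G v ≡ d)

-- walks inside the set of vertices satisfying P (induced subgraph on P)
data WalkIn {n} (G : Graph n) (P : Fin n → Set) : Fin n → Fin n → Set where
  here : ∀ {u} → P u → WalkIn G P u u
  step : ∀ {u w v} → P u → Adj G u w → WalkIn G P w v → WalkIn G P u v

record ⊤' : Set where
  constructor tt'

Connected : ∀ {n} → Graph n → Set
Connected G = ∀ u v → WalkIn G (λ _ → ⊤') u v

KConnected : ∀ {n} → ℕ → Graph n → Set
KConnected {n} k G =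
  k < n × (∀ (S : Subset n) → ∣ S ∣ < k → ∀ u v → u ∉ S → v ∉ S →
           WalkIn G (λ w → w ∉ S) u v)

SubgraphOf : ∀ {n m} → Graph n → Graph m → Set
SubgraphOf {n} {m} G H =
  Σ (Fin n → Fin m) λ f → Injective _≡_ _≡_ f × (∀ u v → Adj G u v → Adj H (f u) (f v))

-- A(n,k,δ) = K_{k-1} ∨ (K_{δ-k+2} ∪ K_{n-δ-1}) on vertex set Fin n:
-- vertices 0..k-2 form the K_{k-1} (part 0), vertices k-1..δ form the
-- K_{δ-k+2} (part 1), vertices δ+1..n-1 form the K_{n-δ-1} (part 2).
part : ∀ {n} → ℕ → ℕ → Fin n → ℕ
part k δ v = if toℕ v <ᵇ k ∸ 1 then 0
             else (if toℕ v <ᵇ suc δ then 1 else 2)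

private
  open import Data.Fin using (_≟_)
  import Data.Nat as N
  open import Relation.Nullary.Decidable using (⌊_⌋)
  open import Data.Bool using (_∧_; _∨_; not)

  adjA : ∀ n → ℕ → ℕ → Fin n → Fin n → Bool
  adjA n k δ u v = not ⌊ u ≟ v ⌋ ∧
    ((⌊ part k δ u N.≟ 0 ⌋ ∨ ⌊ part k δ v N.≟ 0 ⌋) ∨ ⌊ part k δ u N.≟ part k δ v ⌋)

  open import Relation.Binary.PropositionalEquality using (refl; cong₂; cong)
  open import Data.Bool.Properties using (∧-comm; ∨-comm; ∨-assoc)
  open import Relation.Nullary using (Dec; yes; no)
  open import Data.Empty using (⊥-elim)

  eqb-sym : ∀ {A : Set} (d : (x y : A) → Dec (x ≡ y)) x y → ⌊ d x y ⌋ ≡ ⌊ d y x ⌋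
  eqb-sym d x y with d x y | d y x
  ... | yes _ | yes _ = refl
  ... | no _ | no _ = refl
  ... | yes p | no q = ⊥-elim (q (Relation.Binary.PropositionalEquality.sym p))
  ... | no q | yes p = ⊥-elim (q (Relation.Binary.PropositionalEquality.sym p))

  adjA-sym : ∀ n k δ u v → adjA n k δ u v ≡ adjA n k δ v u
  adjA-sym n k δ u v
    rewrite eqb-sym _≟_ u v | eqb-sym N._≟_ (part k δ u) (part k δ v)
          | ∨-comm ⌊ part k δ u N.≟ 0 ⌋ ⌊ part k δ v N.≟ 0 ⌋ = refl

  adjA-irr : ∀ n k δ v → adjA n k δ v v ≡ false
  adjA-irr n k δ v with v ≟ v
  ... | yes _ = refl
  ... | no ¬p = ⊥-elim (¬p refl)

A : (n k δ : ℕ) → Graph n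
A n k δ = record { adj = adjA n k δ ; sym = adjA-sym n k δ ; irrefl = adjA-irr n k δ }

{-# OPTIONS --safe #-}
-- If G is not k-connected, a set S of at most k - 1 vertices separates some u from v. Let X be
-- the vertices reachable from u in G - S and Y the remaining vertices outside S. No edge joins
-- X and Y, so 2m + 2|X||Y| + n ≤ n², and the edge hypothesis gives |X||Y| < (δ-k+3)(n-δ-2).
-- The degrees of u and v give |S| + |X| ≥ δ + 1 and |S| + |Y| ≥ δ + 1; if both sides had
-- at least δ-k+3 vertices their product would be too large, so one side, say X, is small,
-- which forces |S| = k - 1 and |X| = δ-k+2. Listing S, then X, then Y embeds G into
-- A(n,k,δ) = K_{k-1} ∨ (K_{δ-k+2} ∪ K_{n-δ-1}).
module Submission where

open import Defs hiding (sym)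
open import Data.Nat
open import Data.Nat.Properties
open import Data.Nat.Tactic.RingSolver using (solve-∀)
open import Data.Nat.ListAction using () renaming (sum to sumList)
open import Data.Bool using (Bool; true; false; if_then_else_; not; _∧_; _∨_)
open import Data.Bool.Properties using () renaming (_≟_ to _≟ᵇ_)
open import Data.Fin using (Fin; zero; suc; toℕ; fromℕ<)
open import Data.Fin.Properties using (any?; toℕ-injective; toℕ<n; toℕ-fromℕ<) renaming (_≟_ to _≟ᶠ_)
open import Data.Fin.Subset using (Subset; _∉_; ∣_∣)
open import Data.Fin.Subset.Properties using (_∈?_; anySubset?)
open import Data.List using (allFin; tabulate; map)
open import Data.List.Properties using (map-tabulate)
open import Data.Vec using ([]; _∷_; lookup)
open import Data.Vec.Properties using ([]=⇒lookup; lookup⇒[]=)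
open import Algebra.Properties.Semiring.Sum +-*-semiring
  using (sum; sum-syntax; sum-cong-≗; ∑-distrib-+; ∑-comm; *-distribˡ-sum; *-distribʳ-sum)
open import Data.Product using (_×_; _,_; proj₁; proj₂; ∃₂; map₁; map₂)
open import Data.Sum using (_⊎_; inj₁; inj₂)
import Data.Sum as ⊎
open import Data.Empty using (⊥-elim)
open import Relation.Nullary using (Dec; yes; no; does; ¬_; ¬?; _×-dec_)
open import Relation.Nullary.Decidable using (⌊_⌋; isYes≗does; dec-true; dec-false; decidable-stable)
open import Relation.Nullary.Reflects using (ofʸ; ofⁿ)
open import Relation.Unary using (Decidable)
open import Relation.Binary using (tri<; tri≈; tri>)
open import Relation.Binary.PropositionalEquality
open import Function using (_∘_; id)
open import Function.Definitions using (Injective)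

true≢false : true ≢ false
true≢false ()

indicator : Bool → ℕ
indicator b = if b then 1 else 0

indicator≤1 : ∀ b → indicator b ≤ 1
indicator≤1 true  = ≤-refl
indicator≤1 false = z≤n

does-true : ∀ {A : Set} (A? : Dec A) → does A? ≡ true → A
does-true (yes a) _ = a

<ᵇ-true : ∀ {a b} → a < b → (a <ᵇ b) ≡ true
<ᵇ-true {a} {b} a<b with a <ᵇ b | <ᵇ-reflects-< a b
... | true  | _       = refl
... | false | ofⁿ a≮b = ⊥-elim (a≮b a<b)

<ᵇ-false : ∀ {a b} → b ≤ a → (a <ᵇ b) ≡ false
<ᵇ-false {a} {b} b≤a with a <ᵇ b | <ᵇ-reflects-< a b
... | true  | ofʸ a<b = ⊥-elim (<⇒≱ a<b b≤a)
... | false | _       = refl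

indicator-<ᵇ-mono : ∀ {a b c d} → (a < b → c < d) → indicator (a <ᵇ b) ≤ indicator (c <ᵇ d)
indicator-<ᵇ-mono {a} {b} {c} {d} a<b⇒c<d with a <ᵇ b | <ᵇ-reflects-< a b
... | false | _       = z≤n
... | true  | ofʸ a<b rewrite <ᵇ-true (a<b⇒c<d a<b) = ≤-refl

Disjoint : ∀ {n} → (Fin n → Bool) → (Fin n → Bool) → Set
Disjoint X Y = ∀ x → X x ≡ true → Y x ≡ false

sum-tabulate : ∀ {n} (f : Fin n → ℕ) → sumList (tabulate f) ≡ sum f
sum-tabulate {zero}  f = refl
sum-tabulate {suc n} f = cong (f zero +_) (sum-tabulate (f ∘ suc))

sum-allFin : ∀ {n} (f : Fin n → ℕ) → sumList (map f (allFin n)) ≡ sum f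
sum-allFin {n} f = trans (cong sumList (map-tabulate id f)) (sum-tabulate f)

sum-const : ∀ n c → ∑[ i < n ] c ≡ n * c
sum-const zero    c = refl
sum-const (suc n) c = cong (c +_) (sum-const n c)

sum-mono-≤ : ∀ {n} {f g : Fin n → ℕ} → (∀ i → f i ≤ g i) → sum f ≤ sum g
sum-mono-≤ {zero}  f≤g = z≤n
sum-mono-≤ {suc n} f≤g = +-mono-≤ (f≤g zero) (sum-mono-≤ (f≤g ∘ suc))

sum-mono-< : ∀ {n} {f g : Fin n → ℕ} → (∀ i → f i ≤ g i) → ∀ j → f j < g j → sum f < sum g
sum-mono-< f≤g zero    fj<gj = +-mono-<-≤ fj<gj (sum-mono-≤ (f≤g ∘ suc))
sum-mono-< f≤g (suc j) fj<gj = +-mono-≤-< (f≤g zero) (sum-mono-< (f≤g ∘ suc) j fj<gj)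

sum-product : ∀ {m n} (f : Fin m → ℕ) (g : Fin n → ℕ) →
              ∑[ i < m ] ∑[ j < n ] (f i * g j) ≡ sum f * sum g
sum-product f g = begin
  ∑[ i < _ ] ∑[ j < _ ] (f i * g j)  ≡⟨ sum-cong-≗ (λ i → sym (*-distribˡ-sum (f i) g)) ⟩
  ∑[ i < _ ] (f i * sum g)           ≡⟨ sym (*-distribʳ-sum (sum g) f) ⟩
  sum f * sum g                      ∎
  where open ≡-Reasoning

sum₂-distrib-+ : ∀ {m n} (f g : Fin m → Fin n → ℕ) →
                 ∑[ i < m ] ∑[ j < n ] (f i j + g i j) ≡ ∑[ i < m ] ∑[ j < n ] f i j + ∑[ i < m ] ∑[ j < n ] g i j
sum₂-distrib-+ f g = trans (sum-cong-≗ λ i → ∑-distrib-+ (f i) (g i)) (∑-distrib-+ (sum ∘ f) (sum ∘ g))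

count : ∀ {n} → (Fin n → Bool) → ℕ
count {n} X = ∑[ i < n ] indicator (X i)

count<n : ∀ {n} (X : Fin n → Bool) w → X w ≡ false → count X < n
count<n {n} X w Xw≡false = begin-strict
  count X           <⟨ sum-mono-< (indicator≤1 ∘ X) w (subst (λ b → indicator b < 1) (sym Xw≡false) ≤-refl) ⟩
  ∑[ i < n ] 1      ≡⟨ trans (sum-const n 1) (*-identityʳ n) ⟩
  n                 ∎
  where open ≤-Reasoning

indicator-∨ : ∀ a b → indicator (a ∨ b) ≤ indicator a + indicator b
indicator-∨ true  b = m≤m+n 1 (indicator b)
indicator-∨ false b = ≤-refl

count-∨ : ∀ {n} (X Y : Fin n → Bool) → count (λ x → X x ∨ Y x) ≤ count X + count Y
count-∨ X Y = ≤-trans (sum-mono-≤ (λ x → indicator-∨ (X x) (Y x))) (≤-reflexive (∑-distrib-+ (indicator ∘ X) (indicator ∘ Y)))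

count-partition : ∀ {n} (X Y Z : Fin n → Bool) →
                  (∀ x → indicator (X x) + indicator (Y x) + indicator (Z x) ≡ 1) →
                  count X + count Y + count Z ≡ n
count-partition {n} X Y Z one = begin
  count X + count Y + count Z  ≡⟨ cong (_+ count Z) (sym (∑-distrib-+ (indicator ∘ X) (indicator ∘ Y))) ⟩
  ∑[ x < n ] (indicator (X x) + indicator (Y x)) + count Z
                               ≡⟨ sym (∑-distrib-+ (λ x → indicator (X x) + indicator (Y x)) (indicator ∘ Z)) ⟩
  ∑[ x < n ] (indicator (X x) + indicator (Y x) + indicator (Z x))
                               ≡⟨ sum-cong-≗ one ⟩
  ∑[ x < n ] 1                 ≡⟨ trans (sum-const n 1) (*-identityʳ n) ⟩
  n                            ∎
  where open ≡-Reasoning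

*-lowerBound : ∀ a m c d → a ≤ c → a ≤ d → a + m ≤ c + d → a * m ≤ c * d
*-lowerBound a m c d a≤c a≤d a+m≤c+d with m≤n⇒∃[o]m+o≡n a≤c | m≤n⇒∃[o]m+o≡n a≤d
... | c' , refl | d' , refl = begin
  a * m                            ≤⟨ *-monoʳ-≤ a m≤ ⟩
  a * (a + c' + d')                ≤⟨ m≤m+n _ (c' * d') ⟩
  a * (a + c' + d') + c' * d'      ≡⟨ expand a c' d' ⟩
  (a + c') * (a + d')              ∎
  where
    open ≤-Reasoning
    regroup : ∀ a c' d' → a + c' + (a + d') ≡ a + (a + c' + d')
    regroup = solve-∀
    expand : ∀ a c' d' → a * (a + c' + d') + c' * d' ≡ (a + c') * (a + d')
    expand = solve-∀
    m≤ : m ≤ a + c' + d'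
    m≤ = +-cancelˡ-≤ a m _ (≤-trans a+m≤c+d (≤-reflexive (regroup a c' d')))

-- With δ = k + e: a side of at most e + 2 vertices makes both s < k and δ < s + c tight.
small-side : ∀ {k e s c} → s < k → c ≤ e + 2 → k + e < s + c → s + 1 ≡ k × s + c ≡ suc (k + e)
small-side {k} {e} {s} {c} s<k c≤e+2 k+e<s+c = s+1≡k , ≤-antisym upper k+e<s+c
  where
    open ≤-Reasoning
    shift : ∀ s e → s + (e + 2) ≡ s + 1 + (e + 1)
    shift = solve-∀
    k≤s+1 : k ≤ s + 1
    k≤s+1 = +-cancelʳ-≤ (e + 1) k (s + 1) (begin
      k + (e + 1)       ≡⟨ cong (k +_) (+-comm e 1) ⟩
      k + suc e         ≡⟨ +-suc k e ⟩
      suc (k + e)       ≤⟨ k+e<s+c ⟩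
      s + c             ≤⟨ +-monoʳ-≤ s c≤e+2 ⟩
      s + (e + 2)       ≡⟨ shift s e ⟩
      s + 1 + (e + 1)   ∎)
    s+1≡k : s + 1 ≡ k
    s+1≡k = ≤-antisym (subst (_≤ k) (+-comm 1 s) s<k) k≤s+1
    tighten : ∀ s e → s + (e + 2) ≡ suc (s + 1 + e)
    tighten = solve-∀
    upper : s + c ≤ suc (k + e)
    upper = begin
      s + c             ≤⟨ +-monoʳ-≤ s c≤e+2 ⟩
      s + (e + 2)       ≡⟨ tighten s e ⟩
      suc (s + 1 + e)   ≡⟨ cong (λ t → suc (t + e)) s+1≡k ⟩
      suc (k + e)       ∎

separator-sizes : ∀ {k e m s c d} → s < k → s + c + d ≡ k + e + 2 + m →
                  k + e < s + c → k + e < s + d → c * d < (e + 3) * m →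
                  s + 1 ≡ k × (s + c ≡ suc (k + e) ⊎ s + d ≡ suc (k + e))
separator-sizes {k} {e} {m} {s} {c} {d} s<k total k+e<s+c k+e<s+d cd<
  with c ≤? e + 2 | d ≤? e + 2
... | yes c≤e+2 | _         = map₂ inj₁ (small-side s<k c≤e+2 k+e<s+c)
... | no _      | yes d≤e+2 = map₂ inj₂ (small-side s<k d≤e+2 k+e<s+d)
... | no c≰e+2  | no d≰e+2  =
  ⊥-elim (<⇒≱ cd< (*-lowerBound (e + 3) m c d (large c≰e+2) (large d≰e+2) sides))
  where
    open ≤-Reasoning
    large : ∀ {x} → ¬ x ≤ e + 2 → e + 3 ≤ x
    large {x} x≰ = subst (_≤ x) (sym (+-suc e 2)) (≰⇒> x≰)
    regroup₁ : ∀ e m s → e + 3 + m + s ≡ e + 2 + m + suc s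
    regroup₁ = solve-∀
    regroup₂ : ∀ k e m → e + 2 + m + k ≡ k + e + 2 + m
    regroup₂ = solve-∀
    regroup₃ : ∀ s c d → s + c + d ≡ c + d + s
    regroup₃ = solve-∀
    sides : e + 3 + m ≤ c + d
    sides = +-cancelʳ-≤ s _ _ (begin
      e + 3 + m + s          ≡⟨ regroup₁ e m s ⟩
      e + 2 + m + suc s      ≤⟨ +-monoʳ-≤ (e + 2 + m) s<k ⟩
      e + 2 + m + k          ≡⟨ regroup₂ k e m ⟩
      k + e + 2 + m          ≡⟨ sym total ⟩
      s + c + d              ≡⟨ regroup₃ s c d ⟩
      c + d + s              ∎)

δ≤2δ∸k : ∀ {k δ} → k ≤ δ → δ ≤ 2 * δ ∸ k
δ≤2δ∸k {k} {δ} k≤δ = begin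
  δ              ≡⟨ sym (+-identityʳ δ) ⟩
  δ + 0          ≡⟨ sym (m+n∸m≡n δ (δ + 0)) ⟩
  2 * δ ∸ δ      ≤⟨ ∸-monoʳ-≤ (2 * δ) k≤δ ⟩
  2 * δ ∸ k      ∎
  where open ≤-Reasoning

order-bounds : ∀ {k δ n} → k ≤ δ → 2 * δ ∸ k + 5 ≤ n → k < n × δ + 2 ≤ n
order-bounds {k} {δ} {n} k≤δ large =
  ≤-trans (s≤s k≤δ) (≤-trans (m≤n+m (suc δ) 4) 5+δ≤n) ,
  ≤-trans (≤-reflexive (+-comm δ 2)) (≤-trans (m≤n+m (2 + δ) 3) 5+δ≤n)
  where
    5+δ≤n : 5 + δ ≤ n
    5+δ≤n = ≤-trans (+-monoʳ-≤ 5 (δ≤2δ∸k k≤δ)) (subst (_≤ n) (+-comm _ 5) large)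

separator-sizes-δ : ∀ {k δ n s c d} → k ≤ δ → δ + 2 ≤ n → s < k → s + c + d ≡ n →
                    δ < s + c → δ < s + d → c * d < (δ ∸ k + 3) * (n ∸ δ ∸ 2) →
                    s ≡ k ∸ 1 × (s + c ≡ suc δ ⊎ s + d ≡ suc δ)
separator-sizes-δ {k} {s = s} k≤δ δ+2≤n s<k total δ<s+c δ<s+d cd<
  with m≤n⇒∃[o]m+o≡n k≤δ | m≤n⇒∃[o]m+o≡n δ+2≤n
... | e , refl | m , refl =
  map₁ (λ s+1≡k → trans (sym (m+n∸n≡m s 1)) (cong (_∸ 1) s+1≡k))
       (separator-sizes s<k total δ<s+c δ<s+d (subst₂ (λ x y → _ < (x + 3) * y) e≡ m≡ cd<))
  where
    e≡ : k + e ∸ k ≡ e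
    e≡ = m+n∸m≡n k e
    m≡ : k + e + 2 + m ∸ (k + e) ∸ 2 ≡ m
    m≡ = cong (_∸ 2) (trans (cong (_∸ (k + e)) (+-assoc (k + e) 2 m)) (m+n∸m≡n (k + e) (2 + m)))

cancel-edgeBounds : ∀ {n E p q} → 2 * E + 2 * p + n ≤ n * n → n * (n ∸ 1) < 2 * E + 2 * q → p < q
cancel-edgeBounds {n} {E} {p} {q} upper lower =
  *-cancelˡ-< 2 p q (+-cancelˡ-< (2 * E) (2 * p) (2 * q) (+-cancelʳ-< n _ _ (begin-strict
    2 * E + 2 * p + n    ≤⟨ upper ⟩
    n * n                ≡⟨ sym (square n) ⟩
    n * (n ∸ 1) + n      <⟨ +-monoˡ-< n lower ⟩
    2 * E + 2 * q + n    ∎)))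
  where
    open ≤-Reasoning
    square : ∀ n → n * (n ∸ 1) + n ≡ n * n
    square zero    = refl
    square (suc n) = expand n
      where
        expand : ∀ n → suc n * n + suc n ≡ suc n * suc n
        expand = solve-∀

module _ {n} {G : Graph n} {P : Fin n → Set} where

  walkIn-start : ∀ {u v} → WalkIn G P u v → P u
  walkIn-start (here Pu)     = Pu
  walkIn-start (step Pu _ _) = Pu

  walkIn-end : ∀ {u v} → WalkIn G P u v → P v
  walkIn-end (here Pv)     = Pv
  walkIn-end (step _ _ ws) = walkIn-end ws

  walkIn-snoc : ∀ {u w v} → WalkIn G P u w → Adj G w v → P v → WalkIn G P u v
  walkIn-snoc (here Pu)         w~v Pv = step Pu w~v (here Pv)
  walkIn-snoc (step Pu u~u' ws) w~v Pv = step Pu u~u' (walkIn-snoc ws w~v Pv)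

ClosedIn : ∀ {n} → Graph n → (Fin n → Set) → (Fin n → Bool) → Set
ClosedIn G P R = ∀ w w' → R w ≡ true → Adj G w w' → P w' → R w' ≡ true

closedIn-walk : ∀ {n} {G : Graph n} {P R} → ClosedIn G P R →
                ∀ {a b} → WalkIn G P a b → R a ≡ true → R b ≡ true
closedIn-walk closed (here _)        Ra = Ra
closedIn-walk closed (step _ a~w ws) Ra =
  closedIn-walk closed ws (closed _ _ Ra a~w (walkIn-start ws))

module Reachability {n} (G : Graph n) {P : Fin n → Set} (P? : Decidable P) where

  Escape : (Fin n → Bool) → Fin n → Fin n → Set
  Escape R w w' = R w ≡ true × Adj G w w' × P w' × R w' ≡ false

  escape? : ∀ R → Dec (∃₂ (Escape R))
  escape? R = any? λ w → any? λ w' →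
    (R w ≟ᵇ true) ×-dec (adj G w w' ≟ᵇ true) ×-dec P? w' ×-dec (R w' ≟ᵇ false)

  insert : (Fin n → Bool) → Fin n → Fin n → Bool
  insert R w x with x ≟ᶠ w
  ... | yes _ = true
  ... | no  _ = R x

  insert-self : ∀ R w → insert R w w ≡ true
  insert-self R w with w ≟ᶠ w
  ... | yes _   = refl
  ... | no  w≢w = ⊥-elim (w≢w refl)

  insert-⊇ : ∀ R w x → R x ≡ true → insert R w x ≡ true
  insert-⊇ R w x Rx with x ≟ᶠ w
  ... | yes _ = refl
  ... | no  _ = Rx

  count-insert : ∀ R w → R w ≡ false → count R < count (insert R w)
  count-insert R w Rw≡false = sum-mono-< grows w new
    where
      grows : ∀ x → indicator (R x) ≤ indicator (insert R w x)
      grows x with x ≟ᶠ w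
      ... | yes _ = indicator≤1 (R x)
      ... | no  _ = ≤-refl
      new : indicator (R w) < indicator (insert R w w)
      new rewrite Rw≡false | insert-self R w = ≤-refl

  record Closure (u : Fin n) : Set where
    field
      R        : Fin n → Bool
      R-start  : R u ≡ true
      R-sound  : ∀ w → R w ≡ true → WalkIn G P u w
      R-closed : ClosedIn G P R

  -- Add escaping vertices one at a time; each one raises count R, which stays below n while anything escapes.
  grow : ∀ {u} (fuel : ℕ) (R : Fin n → Bool) → n ≤ count R + fuel → R u ≡ true →
         (∀ w → R w ≡ true → WalkIn G P u w) → Closure u
  grow fuel R room Ru sound with escape? R
  grow zero R room Ru sound | yes (_ , w' , _ , _ , _ , Rw'≡false) =
    ⊥-elim (<⇒≱ (count<n R w' Rw'≡false) (subst (n ≤_) (+-identityʳ _) room))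
  grow {u} (suc fuel) R room Ru sound | yes (w , w' , Rw , w~w' , Pw' , Rw'≡false) =
    grow fuel (insert R w') room' (insert-⊇ R w' u Ru) sound'
    where
      room' : n ≤ count (insert R w') + fuel
      room' = ≤-trans room (≤-trans (≤-reflexive (+-suc _ fuel))
                                    (+-monoˡ-≤ fuel (count-insert R w' Rw'≡false)))
      sound' : ∀ x → insert R w' x ≡ true → WalkIn G P u x
      sound' x Rx with x ≟ᶠ w'
      ... | yes refl = walkIn-snoc (sound w Rw) w~w' Pw'
      ... | no  _    = sound x Rx
  grow fuel R room Ru sound | no no-escape = record
    { R = R ; R-start = Ru ; R-sound = sound ; R-closed = closed }
    where
      closed : ClosedIn G P R
      closed w w' Rw w~w' Pw' with R w' in Rw'
      ... | true  = refl
      ... | false = ⊥-elim (no-escape (w , w' , Rw , w~w' , Pw' , Rw'))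

  closure : ∀ {u} → P u → Closure u
  closure {u} Pu = grow n (insert (λ _ → false) u) (m≤n+m n _) (insert-self _ u) sound
    where
      sound : ∀ w → insert (λ _ → false) u w ≡ true → WalkIn G P u w
      sound w Rw with w ≟ᶠ u
      sound w Rw | yes refl = here Pu

  closure-decides : ∀ {u} → Closure u → ∀ v → Dec (WalkIn G P u v)
  closure-decides c v with Closure.R c v in Rv
  ... | true  = yes (Closure.R-sound c v Rv)
  ... | false = no λ walk → true≢false (trans (sym (closedIn-walk (Closure.R-closed c) walk (Closure.R-start c))) Rv)

  walkIn? : ∀ u v → Dec (WalkIn G P u v)
  walkIn? u v with P? u
  ... | no ¬Pu = no (¬Pu ∘ walkIn-start)
  ... | yes Pu = closure-decides (closure Pu) v

at-most-one-pair : ∀ a x₁ y₁ x₂ y₂ → (x₁ ≡ true → y₁ ≡ false) →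
                   (x₁ ≡ true → y₂ ≡ true → a ≡ false) → (y₁ ≡ true → x₂ ≡ true → a ≡ false) →
                   indicator a + indicator x₁ * indicator y₂ + indicator y₁ * indicator x₂ ≤ 1
at-most-one-pair a     true  true  x₂    y₂    x₁⇒¬y₁ _ _ = ⊥-elim (true≢false (x₁⇒¬y₁ refl))
at-most-one-pair a     true  false x₂    true  _ xy⇒¬a _ rewrite xy⇒¬a refl refl = ≤-refl
at-most-one-pair true  true  false x₂    false _ _ _ = ≤-refl
at-most-one-pair false true  false x₂    false _ _ _ = z≤n
at-most-one-pair a     false true  true  y₂    _ _ yx⇒¬a rewrite yx⇒¬a refl refl = ≤-refl
at-most-one-pair true  false true  false y₂    _ _ _ = ≤-refl
at-most-one-pair false false true  false y₂    _ _ _ = z≤n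
at-most-one-pair true  false false x₂    y₂    _ _ _ = ≤-refl
at-most-one-pair false false false x₂    y₂    _ _ _ = z≤n

module _ {n} (G : Graph n) where

  adjacencySum : ℕ
  adjacencySum = ∑[ u < n ] ∑[ v < n ] indicator (adj G u v)

  edgeCount≡sum : edgeCount G ≡ ∑[ u < n ] ∑[ v < n ] indicator (adj G u v ∧ (toℕ u <ᵇ toℕ v))
  edgeCount≡sum = trans (sum-allFin row) (sum-cong-≗ λ u → trans (sum-allFin (entry u)) (sum-cong-≗ (term u)))
    where
      entry : Fin n → Fin n → ℕ
      entry u v = if adj G u v then (if toℕ u <ᵇ toℕ v then 1 else 0) else 0
      row : Fin n → ℕ
      row u = sumList (map (entry u) (allFin n))
      term : ∀ u v → entry u v ≡ indicator (adj G u v ∧ (toℕ u <ᵇ toℕ v))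
      term u v with adj G u v
      ... | true  = refl
      ... | false = refl

  ordered-pairs : ∀ u v → indicator (adj G u v ∧ (toℕ u <ᵇ toℕ v)) + indicator (adj G v u ∧ (toℕ v <ᵇ toℕ u))
                          ≡ indicator (adj G u v)
  ordered-pairs u v rewrite Graph.sym G v u with adj G u v in u~v | <-cmp (toℕ u) (toℕ v)
  ... | false | _             = refl
  ... | true  | tri< u<v _ _  rewrite <ᵇ-true u<v | <ᵇ-false (<⇒≤ u<v) = refl
  ... | true  | tri> _ _ v<u  rewrite <ᵇ-false (<⇒≤ v<u) | <ᵇ-true v<u = refl
  ... | true  | tri≈ _ u≡v _  with toℕ-injective u≡v
  ...   | refl = ⊥-elim (true≢false (trans (sym u~v) (irrefl G u)))

  double-edgeCount : 2 * edgeCount G ≡ adjacencySum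
  double-edgeCount = begin
    2 * edgeCount G                ≡⟨ cong (edgeCount G +_) (+-identityʳ (edgeCount G)) ⟩
    edgeCount G + edgeCount G      ≡⟨ cong₂ _+_ edgeCount≡sum (trans edgeCount≡sum (∑-comm ordered)) ⟩
    ∑[ u < n ] ∑[ v < n ] ordered u v + ∑[ u < n ] ∑[ v < n ] ordered v u
                                   ≡⟨ sym (sum₂-distrib-+ ordered (λ u v → ordered v u)) ⟩
    ∑[ u < n ] ∑[ v < n ] (ordered u v + ordered v u)
                                   ≡⟨ sum-cong-≗ (λ u → sum-cong-≗ (ordered-pairs u)) ⟩
    adjacencySum                   ∎
    where
      open ≡-Reasoning
      ordered : Fin n → Fin n → ℕ
      ordered u v = indicator (adj G u v ∧ (toℕ u <ᵇ toℕ v))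

  NoEdgesBetween : (Fin n → Bool) → (Fin n → Bool) → Set
  NoEdgesBetween X Y = ∀ x y → X x ≡ true → Y y ≡ true → adj G x y ≡ false

  -- Each ordered pair (u, v) with u ≢ v is counted at most once: as an edge, or as an X–Y or Y–X pair.
  edgeCount-nonEdges : ∀ X Y → Disjoint X Y → NoEdgesBetween X Y →
                       2 * edgeCount G + 2 * (count X * count Y) + n ≤ n * n
  edgeCount-nonEdges X Y X∩Y=∅ no-edges = begin
    2 * edgeCount G + 2 * (count X * count Y) + n
        ≡⟨ cong (λ e → e + 2 * (count X * count Y) + n) double-edgeCount ⟩
    adjacencySum + 2 * (count X * count Y) + n
        ≡⟨ regroup adjacencySum (count X) (count Y) n ⟩
    adjacencySum + count X * count Y + count Y * count X + n
        ≡⟨ cong (_+ n) (sym total) ⟩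
    ∑[ u < n ] ∑[ v < n ] pair u v + n
        ≡⟨ cong (∑[ u < n ] ∑[ v < n ] pair u v +_) (sym (trans (sum-const n 1) (*-identityʳ n))) ⟩
    ∑[ u < n ] ∑[ v < n ] pair u v + ∑[ u < n ] 1
        ≡⟨ sym (∑-distrib-+ (λ u → ∑[ v < n ] pair u v) (λ _ → 1)) ⟩
    ∑[ u < n ] (∑[ v < n ] pair u v + 1)
        ≤⟨ sum-mono-≤ (λ u → subst (_≤ n) (+-comm 1 _) (row u)) ⟩
    ∑[ u < n ] n
        ≡⟨ sum-const n n ⟩
    n * n ∎
    where
      open ≤-Reasoning
      regroup : ∀ a p q n → a + 2 * (p * q) + n ≡ a + p * q + q * p + n
      regroup = solve-∀
      pair : Fin n → Fin n → ℕ
      pair u v = indicator (adj G u v) + indicator (X u) * indicator (Y v) + indicator (Y u) * indicator (X v)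
      pair≤1 : ∀ u v → pair u v ≤ 1
      pair≤1 u v = at-most-one-pair (adj G u v) (X u) (Y u) (X v) (Y v) (X∩Y=∅ u) (no-edges u v)
                     (λ Yu Xv → trans (Graph.sym G u v) (no-edges v u Xv Yu))
      diagonal : ∀ u → pair u u < 1
      diagonal u rewrite irrefl G u with X u in Xu | Y u in Yu
      ... | true  | true  = ⊥-elim (true≢false (trans (sym Yu) (X∩Y=∅ u Xu)))
      ... | true  | false = ≤-refl
      ... | false | true  = ≤-refl
      ... | false | false = ≤-refl
      row : ∀ u → ∑[ v < n ] pair u v < n
      row u = ≤-trans (sum-mono-< (pair≤1 u) u (diagonal u)) (≤-reflexive (trans (sum-const n 1) (*-identityʳ n)))
      total : ∑[ u < n ] ∑[ v < n ] pair u v ≡ adjacencySum + count X * count Y + count Y * count X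
      total = trans (sum₂-distrib-+ _ (λ u v → indicator (Y u) * indicator (X v)))
              (cong₂ _+_ (trans (sum₂-distrib-+ (λ u v → indicator (adj G u v)) _)
                                (cong (adjacencySum +_) (sum-product (indicator ∘ X) (indicator ∘ Y))))
                         (sum-product (indicator ∘ Y) (indicator ∘ X)))

  degree<count : ∀ z (W : Fin n → Bool) → (∀ w → Adj G z w → W w ≡ true) → W z ≡ true → degree G z < count W
  degree<count z W N⊆W Wz = begin-strict
    degree G z                         ≡⟨ sum-allFin (indicator ∘ adj G z) ⟩
    ∑[ w < n ] indicator (adj G z w)   <⟨ sum-mono-< neighbour z self ⟩
    count W                            ∎
    where
      open ≤-Reasoning
      neighbour : ∀ w → indicator (adj G z w) ≤ indicator (W w)
      neighbour w with adj G z w in z~w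
      ... | true  rewrite N⊆W w z~w = ≤-refl
      ... | false = z≤n
      self : indicator (adj G z z) < indicator (W z)
      self rewrite irrefl G z | Wz = ≤-refl

-- Sort the vertices by label, breaking ties by index; the key ℓ x * n + toℕ x realises this order.
module SortByLabel {n} (ℓ : Fin n → ℕ) where

  key : Fin n → ℕ
  key x = ℓ x * n + toℕ x

  key-mono : ∀ {x y} → ℓ x < ℓ y → key x < key y
  key-mono {x} {y} ℓx<ℓy = begin-strict
    ℓ x * n + toℕ x    <⟨ +-monoʳ-< (ℓ x * n) (toℕ<n x) ⟩
    ℓ x * n + n        ≡⟨ +-comm (ℓ x * n) n ⟩
    suc (ℓ x) * n      ≤⟨ *-monoˡ-≤ n ℓx<ℓy ⟩
    ℓ y * n            ≤⟨ m≤m+n (ℓ y * n) (toℕ y) ⟩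
    key y              ∎
    where open ≤-Reasoning

  key-<⇒ℓ-≤ : ∀ {x y} → key x < key y → ℓ x ≤ ℓ y
  key-<⇒ℓ-≤ kx<ky = ≮⇒≥ (λ ℓy<ℓx → <-asym kx<ky (key-mono ℓy<ℓx))

  key-injective : ∀ {x y} → key x ≡ key y → x ≡ y
  key-injective {x} {y} kx≡ky with <-cmp (ℓ x) (ℓ y)
  ... | tri< ℓx<ℓy _ _ = ⊥-elim (<⇒≢ (key-mono ℓx<ℓy) kx≡ky)
  ... | tri> _ _ ℓy<ℓx = ⊥-elim (<⇒≢ (key-mono ℓy<ℓx) (sym kx≡ky))
  ... | tri≈ _ ℓx≡ℓy _ = toℕ-injective (+-cancelˡ-≡ (ℓ x * n) (toℕ x) (toℕ y)
                                          (trans kx≡ky (cong (λ l → l * n + toℕ y) (sym ℓx≡ℓy))))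

  rank : Fin n → ℕ
  rank x = count (λ y → key y <ᵇ key x)

  rank<n : ∀ x → rank x < n
  rank<n x = count<n _ x (<ᵇ-false (≤-refl {key x}))

  rank-mono : ∀ {x y} → key x < key y → rank x < rank y
  rank-mono {x} {y} kx<ky = sum-mono-< (λ z → indicator-<ᵇ-mono (λ kz<kx → <-trans kz<kx kx<ky)) x self
    where
      self : indicator (key x <ᵇ key x) < indicator (key x <ᵇ key y)
      self rewrite <ᵇ-false (≤-refl {key x}) | <ᵇ-true kx<ky = ≤-refl

  rank-injective : ∀ {x y} → rank x ≡ rank y → x ≡ y
  rank-injective {x} {y} rx≡ry with <-cmp (key x) (key y)
  ... | tri< kx<ky _ _ = ⊥-elim (<⇒≢ (rank-mono kx<ky) rx≡ry)
  ... | tri≈ _ kx≡ky _ = key-injective kx≡ky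
  ... | tri> _ _ ky<kx = ⊥-elim (<⇒≢ (rank-mono ky<kx) (sym rx≡ry))

  position : Fin n → Fin n
  position x = fromℕ< (rank<n x)

  position-injective : Injective _≡_ _≡_ position
  position-injective {x} {y} px≡py = rank-injective (begin
    rank x                ≡⟨ sym (toℕ-fromℕ< (rank<n x)) ⟩
    toℕ (position x)      ≡⟨ cong toℕ px≡py ⟩
    toℕ (position y)      ≡⟨ toℕ-fromℕ< (rank<n y) ⟩
    rank y                ∎)
    where open ≡-Reasoning

  below : ℕ → ℕ
  below t = count (λ y → ℓ y <ᵇ t)

  below≤position : ∀ x → below (ℓ x) ≤ toℕ (position x)
  below≤position x = begin
    below (ℓ x)           ≤⟨ sum-mono-≤ {n} (λ y → indicator-<ᵇ-mono key-mono) ⟩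
    rank x                ≡⟨ sym (toℕ-fromℕ< (rank<n x)) ⟩
    toℕ (position x)      ∎
    where open ≤-Reasoning

  position<below : ∀ x → toℕ (position x) < below (suc (ℓ x))
  position<below x = begin-strict
    toℕ (position x)      ≡⟨ toℕ-fromℕ< (rank<n x) ⟩
    rank x                <⟨ sum-mono-< {n} (λ y → indicator-<ᵇ-mono (s≤s ∘ key-<⇒ℓ-≤)) x self ⟩
    below (suc (ℓ x))     ∎
    where
      open ≤-Reasoning
      self : indicator (key x <ᵇ key x) < indicator (ℓ x <ᵇ suc (ℓ x))
      self rewrite <ᵇ-false (≤-refl {key x}) | <ᵇ-true (≤-refl {suc (ℓ x)}) = ≤-refl

module _ {n : ℕ} (k δ : ℕ) where

  part≡0 : ∀ {y : Fin n} → toℕ y < k ∸ 1 → part k δ y ≡ 0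
  part≡0 y<k-1 rewrite <ᵇ-true y<k-1 = refl

  part≡1 : ∀ {y : Fin n} → k ∸ 1 ≤ toℕ y → toℕ y < suc δ → part k δ y ≡ 1
  part≡1 k-1≤y y≤δ rewrite <ᵇ-false k-1≤y | <ᵇ-true y≤δ = refl

  part≡2 : ∀ {y : Fin n} → k ∸ 1 ≤ toℕ y → suc δ ≤ toℕ y → part k δ y ≡ 2
  part≡2 k-1≤y δ<y rewrite <ᵇ-false k-1≤y | <ᵇ-false δ<y = refl

  A-adjacent : ∀ {a b : Fin n} → a ≢ b →
               part k δ a ≡ 0 ⊎ part k δ b ≡ 0 ⊎ part k δ a ≡ part k δ b → Adj (A n k δ) a b
  A-adjacent {a} {b} a≢b parts = rule (isNo a≢b) (yesses parts)
    where
      -- Adj (A n k δ) a b unfolds to the Boolean formula of rule.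
      isYes-true : ∀ {P : Set} (P? : Dec P) → P → ⌊ P? ⌋ ≡ true
      isYes-true P? p = trans (isYes≗does P?) (dec-true P? p)
      isNo : a ≢ b → ⌊ a ≟ᶠ b ⌋ ≡ false
      isNo a≢b = trans (isYes≗does (a ≟ᶠ b)) (dec-false (a ≟ᶠ b) a≢b)
      yesses : part k δ a ≡ 0 ⊎ part k δ b ≡ 0 ⊎ part k δ a ≡ part k δ b →
               ⌊ part k δ a ≟ 0 ⌋ ≡ true ⊎ ⌊ part k δ b ≟ 0 ⌋ ≡ true ⊎ ⌊ part k δ a ≟ part k δ b ⌋ ≡ true
      yesses = ⊎.map (isYes-true (_ ≟ 0)) (⊎.map (isYes-true (_ ≟ 0)) (isYes-true (_ ≟ _)))
      rule : ∀ {x y z w} → x ≡ false → y ≡ true ⊎ z ≡ true ⊎ w ≡ true → (not x ∧ ((y ∨ z) ∨ w)) ≡ true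
      rule {y = true}  refl _ = refl
      rule {y = false} {true} refl _ = refl
      rule {y = false} {false} {true} refl _ = refl
      rule {y = false} {false} {false} refl (inj₁ ())
      rule {y = false} {false} {false} refl (inj₂ (inj₁ ()))
      rule {y = false} {false} {false} refl (inj₂ (inj₂ ()))

module _ {n} (G : Graph n) (k δ : ℕ) (σ X : Fin n → Bool) where

  label : Fin n → ℕ
  label x = if σ x then 0 else (if X x then 1 else 2)

  label≤2 : ∀ x → label x ≤ 2
  label≤2 x with σ x | X x
  ... | true  | _     = z≤n
  ... | false | true  = s≤s z≤n
  ... | false | false = ≤-refl

  open SortByLabel label

  module _ (σ∩X=∅ : Disjoint σ X) where

    below-1 : below 1 ≡ count σ
    below-1 = sum-cong-≗ pointwise
      where
        pointwise : ∀ x → indicator (label x <ᵇ 1) ≡ indicator (σ x)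
        pointwise x with σ x | X x
        ... | true  | _     = refl
        ... | false | true  = refl
        ... | false | false = refl

    below-2 : below 2 ≡ count σ + count X
    below-2 = trans (sum-cong-≗ pointwise) (∑-distrib-+ (indicator ∘ σ) (indicator ∘ X))
      where
        pointwise : ∀ x → indicator (label x <ᵇ 2) ≡ indicator (σ x) + indicator (X x)
        pointwise x with σ x in σx | X x in Xx
        ... | true  | true  = ⊥-elim (true≢false (trans (sym Xx) (σ∩X=∅ x σx)))
        ... | true  | false = refl
        ... | false | true  = refl
        ... | false | false = refl

    module _ (|σ| : count σ ≡ k ∸ 1) (|σ∪X| : count σ + count X ≡ suc δ) where

      k-1≤below-2 : k ∸ 1 ≤ below 2
      k-1≤below-2 = subst₂ _≤_ |σ| (sym below-2) (m≤m+n (count σ) (count X))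

      part-by-below : ∀ {y : Fin n} l → l ≤ 2 → below l ≤ toℕ y → toℕ y < below (suc l) → part k δ y ≡ l
      part-by-below 0 _ _   y<b = part≡0 k δ (subst (_ <_) (trans below-1 |σ|) y<b)
      part-by-below 1 _ b≤y y<b = part≡1 k δ (subst (_≤ _) (trans below-1 |σ|) b≤y)
                                             (subst (_ <_) (trans below-2 |σ∪X|) y<b)
      part-by-below 2 _ b≤y _   = part≡2 k δ (≤-trans k-1≤below-2 b≤y) (subst (_≤ _) (trans below-2 |σ∪X|) b≤y)
      part-by-below (suc (suc (suc _))) (s≤s (s≤s ())) _ _

      part-position : ∀ x → part k δ (position x) ≡ label x
      part-position x = part-by-below (label x) (label≤2 x) (below≤position x) (position<below x)

      module _ (X-closed : ClosedIn G (λ w → σ w ≡ false) X) where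

        label-edge : ∀ {u v} → Adj G u v → label u ≡ 0 ⊎ label v ≡ 0 ⊎ label u ≡ label v
        label-edge {u} {v} u~v with σ u in σu | σ v in σv | X u in Xu | X v in Xv
        ... | true  | _     | _     | _     = inj₁ refl
        ... | false | true  | _     | _     = inj₂ (inj₁ refl)
        ... | false | false | true  | true  = inj₂ (inj₂ refl)
        ... | false | false | false | false = inj₂ (inj₂ refl)
        ... | false | false | true  | false =
          ⊥-elim (true≢false (trans (sym (X-closed u v Xu u~v σv)) Xv))
        ... | false | false | false | true  =
          ⊥-elim (true≢false (trans (sym (X-closed v u Xv (trans (Graph.sym G v u) u~v) σu)) Xu))

        subgraphOfA : SubgraphOf G (A n k δ)
        subgraphOfA = position , position-injective , edge
          where
            edge : ∀ u v → Adj G u v → Adj (A n k δ) (position u) (position v)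
            edge u v u~v = A-adjacent k δ (u≢v ∘ position-injective)
              (subst₂ (λ p q → p ≡ 0 ⊎ q ≡ 0 ⊎ p ≡ q) (sym (part-position u)) (sym (part-position v)) (label-edge u~v))
              where
                u≢v : u ≢ v
                u≢v refl = true≢false (trans (sym u~v) (irrefl G u))

neither : ∀ {n} → (Fin n → Bool) → (Fin n → Bool) → Fin n → Bool
neither σ X w = not (σ w) ∧ not (X w)

module _ {n} {σ X : Fin n → Bool} where

  neither⇒ : ∀ {w} → neither σ X w ≡ true → σ w ≡ false × X w ≡ false
  neither⇒ {w} neither-w with σ w | X w
  ... | false | false = refl , refl
  ... | true  | _     = ⊥-elim (true≢false (sym neither-w))
  ... | false | true  = ⊥-elim (true≢false (sym neither-w))

  σ∩neither=∅ : Disjoint σ (neither σ X)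
  σ∩neither=∅ w σw rewrite σw = refl

  X∩neither=∅ : Disjoint X (neither σ X)
  X∩neither=∅ w Xw rewrite Xw with σ w
  ... | true  = refl
  ... | false = refl

  count-sides : Disjoint σ X → count σ + count X + count (neither σ X) ≡ n
  count-sides σ∩X=∅ = count-partition σ X (neither σ X) one
    where
      one : ∀ w → indicator (σ w) + indicator (X w) + indicator (neither σ X w) ≡ 1
      one w with σ w in σw | X w in Xw
      ... | true  | true  = ⊥-elim (true≢false (trans (sym Xw) (σ∩X=∅ w σw)))
      ... | true  | false = refl
      ... | false | true  = refl
      ... | false | false = refl

module _ {n} (G : Graph n) {σ X : Fin n → Bool} (X-closed : ClosedIn G (λ w → σ w ≡ false) X) where

  degree<closed : ∀ z → X z ≡ true → degree G z < count σ + count X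
  degree<closed z Xz = ≤-trans (degree<count G z (λ w → σ w ∨ X w) neighbour (self (σ z)))
                               (count-∨ σ X)
    where
      self : ∀ b → (b ∨ X z) ≡ true
      self true  = refl
      self false = Xz
      neighbour : ∀ w → Adj G z w → (σ w ∨ X w) ≡ true
      neighbour w z~w with σ w in σw
      ... | true  = refl
      ... | false = X-closed z w Xz z~w σw

  neither-closed : ClosedIn G (λ w → σ w ≡ false) (neither σ X)
  neither-closed w w' neither-w w~w' σw' rewrite σw' with X w' in Xw'
  ... | false = refl
  ... | true  = ⊥-elim (true≢false (trans (sym (X-closed w' w Xw' (trans (Graph.sym G w' w) w~w') σw)) Xw))
    where
      σw = proj₁ (neither⇒ {σ = σ} {X} neither-w)
      Xw = proj₂ (neither⇒ {σ = σ} {X} neither-w)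

  no-edges-X-neither : NoEdgesBetween G X (neither σ X)
  no-edges-X-neither x y Xx neither-y with adj G x y in x~y
  ... | false = refl
  ... | true  = ⊥-elim (true≢false (trans (sym (X-closed x y Xx x~y σy)) Xy))
    where
      σy = proj₁ (neither⇒ {σ = σ} {X} neither-y)
      Xy = proj₂ (neither⇒ {σ = σ} {X} neither-y)

∉⇒lookup≡false : ∀ {n} {S : Subset n} {x} → x ∉ S → lookup S x ≡ false
∉⇒lookup≡false {S = S} {x} x∉S with lookup S x in Sx
... | true  = ⊥-elim (x∉S (lookup⇒[]= x S Sx))
... | false = refl

lookup≡false⇒∉ : ∀ {n} {S : Subset n} {x} → lookup S x ≡ false → x ∉ S
lookup≡false⇒∉ Sx≡false x∈S = true≢false (trans (sym ([]=⇒lookup x∈S)) Sx≡false)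

∣S∣≡count : ∀ {n} (S : Subset n) → ∣ S ∣ ≡ count (lookup S)
∣S∣≡count []          = refl
∣S∣≡count (true ∷ S)  = cong suc (∣S∣≡count S)
∣S∣≡count (false ∷ S) = ∣S∣≡count S

record Separator {n} (k : ℕ) (G : Graph n) : Set where
  field
    S            : Subset n
    u v          : Fin n
    small        : ∣ S ∣ < k
    u∉S          : u ∉ S
    v∉S          : v ∉ S
    disconnected : ¬ WalkIn G (_∉ S) u v

connected? : ∀ {n} (G : Graph n) (S : Subset n) u v → Dec (WalkIn G (_∉ S) u v)
connected? G S = Reachability.walkIn? G (λ w → ¬? (w ∈? S))

robust-or-separator : ∀ {n} k (G : Graph n) →
  (∀ (S : Subset n) → ∣ S ∣ < k → ∀ u v → u ∉ S → v ∉ S → WalkIn G (_∉ S) u v) ⊎ Separator k G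
robust-or-separator {n} k G with anySubset? (λ S → any? λ u → any? λ v →
  (∣ S ∣ <? k) ×-dec ¬? (u ∈? S) ×-dec ¬? (v ∈? S) ×-dec ¬? (connected? G S u v))
... | yes (S , u , v , small , u∉S , v∉S , disconnected) = inj₂ (record
  { S = S ; u = u ; v = v ; small = small ; u∉S = u∉S ; v∉S = v∉S ; disconnected = disconnected })
... | no no-separator = inj₁ λ S small u v u∉S v∉S → decidable-stable (connected? G S u v)
  λ disconnected → no-separator (S , u , v , small , u∉S , v∉S , disconnected)

module SeparatorArgument {n k δ : ℕ} {G : Graph n} (sep : Separator k G) where
  open Separator sep

  σ : Fin n → Bool
  σ = lookup S

  X : Fin n → Bool
  X w = does (connected? G S u w)

  σ∩X=∅ : Disjoint σ X
  σ∩X=∅ w σw with connected? G S u w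
  ... | yes walk = ⊥-elim (true≢false (trans (sym σw) (∉⇒lookup≡false (walkIn-end walk))))
  ... | no  _    = refl

  X-closed : ClosedIn G (λ w → σ w ≡ false) X
  X-closed w w' Xw w~w' σw' =
    dec-true (connected? G S u w') (walkIn-snoc (does-true (connected? G S u w) Xw) w~w' (lookup≡false⇒∉ σw'))

  Y : Fin n → Bool
  Y = neither σ X

  u∈X : X u ≡ true
  u∈X = dec-true (connected? G S u u) (here u∉S)

  v∈Y : Y v ≡ true
  v∈Y rewrite ∉⇒lookup≡false v∉S | dec-false (connected? G S u v) disconnected = refl

  module _ (k≤δ : k ≤ δ) (δ+2≤n : δ + 2 ≤ n) (δ≤degree : ∀ w → δ ≤ degree G w)
           (dense : n * (n ∸ 1) < 2 * edgeCount G + 2 * ((δ ∸ k + 3) * (n ∸ δ ∸ 2))) where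

    sizes : count σ ≡ k ∸ 1 × (count σ + count X ≡ suc δ ⊎ count σ + count Y ≡ suc δ)
    sizes = separator-sizes-δ k≤δ δ+2≤n (subst (_< k) (∣S∣≡count S) small) (count-sides σ∩X=∅)
      (≤-<-trans (δ≤degree u) (degree<closed G X-closed u u∈X))
      (≤-<-trans (δ≤degree v) (degree<closed G (neither-closed G X-closed) v v∈Y))
      (cancel-edgeBounds {E = edgeCount G} (edgeCount-nonEdges G X Y (X∩neither=∅ {σ = σ}) (no-edges-X-neither G X-closed)) dense)

    separator⇒subgraphOfA : SubgraphOf G (A n k δ)
    separator⇒subgraphOfA with sizes
    ... | |σ| , inj₁ |σ∪X| = subgraphOfA G k δ σ X σ∩X=∅ |σ| |σ∪X| X-closed
    ... | |σ| , inj₂ |σ∪Y| = subgraphOfA G k δ σ Y (σ∩neither=∅ {X = X}) |σ| |σ∪Y| (neither-closed G X-closed)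

lemma2p3 : (k δ n : ℕ) (G : Graph n) →
    2 ≤ k → k ≤ δ → 2 * δ ∸ k + 5 ≤ n →
    Connected G → MinDegree G δ →
    n * (n ∸ 1) < 2 * edgeCount G + 2 * ((δ ∸ k + 3) * (n ∸ δ ∸ 2)) →
    KConnected k G ⊎ SubgraphOf G (A n k δ)
lemma2p3 k δ n G _ k≤δ large _ (δ≤degree , _) dense with order-bounds k≤δ large | robust-or-separator k G
... | k<n , _      | inj₁ robust = inj₁ (k<n , robust)
... | _ , δ+2≤n    | inj₂ sep    = inj₂ (SeparatorArgument.separator⇒subgraphOfA sep k≤δ δ+2≤n δ≤degree dense)
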